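{- Let $c$ be a $3$-coloring of the nonzero rational numbers with no monochromatic solution to $x_0+\tfrac{3}{2}x_1=\tfrac{9}{4}x_2$. If $x$ is a nonzero rational number such that $c(x)=c(2x)$, then for every positive integer $n$, we have $c(nx)=c(x)$ if and only if $v_3(n)$ is a multiple of $3$.
   Context: A solution is a triple of nonzero rationals (not necessarily distinct) satisfying the equation; it is monochromatic if all entries have the same color. For a positive integer $n$, $v_3(n)$ is the exponent of $3$ in the prime factorization of $n$. -}

module Defs where

open import Data.Nat as ℕ using (ℕ; suc; _^_)
open import Data.Nat.Divisibility using (_∣_)
open import Data.Integer using (+_)
open import Data.Rational using (ℚ; 0ℚ; _+_; _*_; _/_)
open import Data.Fin using (Fin)
open import Data.Product using (∃; _×_)
open import Relation.Nullary using (¬_)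
open import Relation.Binary.PropositionalEquality using (_≡_; _≢_)

-- A 3-coloring of the nonzero rationals: a map ℚ → Fin 3 whose value at 0 is
-- irrelevant (all conditions below only involve nonzero rationals).
Coloring : Set
Coloring = ℚ → Fin 3

three/two : ℚ
three/two = + 3 / 2

nine/four : ℚ
nine/four = + 9 / 4

ℕtoℚ : ℕ → ℚ
ℕtoℚ n = + n / 1

IsSolution : ℚ → ℚ → ℚ → Set
IsSolution x₀ x₁ x₂ =
  x₀ ≢ 0ℚ × x₁ ≢ 0ℚ × x₂ ≢ 0ℚ × (x₀ + three/two * x₁ ≡ nine/four * x₂)

NoMonoSolution : Coloring → Set
NoMonoSolution c = ∀ x₀ x₁ x₂ → IsSolution x₀ x₁ x₂ →
  ¬ (c x₀ ≡ c x₁ × c x₁ ≡ c x₂)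

V3 : ℕ → ℕ → Set
V3 n k = (3 ^ k ∣ n) × ¬ (3 ^ suc k ∣ n)

V3MultipleOf3 : ℕ → Set
V3MultipleOf3 n = ∃ λ m → V3 n (3 ℕ.* m)

module Submission where

open import Defs
open import Data.Nat using (ℕ; NonZero)
open import Data.Rational using (ℚ; 0ℚ; _*_)
open import Relation.Binary.PropositionalEquality using (_≡_; _≢_)
open import Function.Bundles using (_⇔_)

open import Data.Bool.Base using (Bool; true; false; T; _∧_; if_then_else_)
open import Data.Bool.ListAction using (all; any)
open import Data.Bool.Properties using (T-∧)
open import Data.Empty using (⊥; ⊥-elim)
open import Data.Fin.Base using (Fin; zero; suc)
open import Data.Fin.Properties using (punchOut-injective) renaming (_≟_ to _≟ᶠ_)
open import Data.Integer.Base as ℤ using (+_)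
import Data.Integer.Properties as ℤ
open import Data.List.Base using (List; []; _∷_; _++_; map)
open import Data.List.Relation.Unary.All as All using (All; []; _∷_)
import Data.List.Relation.Unary.All.Properties as All
open import Data.List.Relation.Unary.Any.Properties using (any⁻)
open import Data.Maybe.Base using (Maybe; just; nothing)
open import Data.Nat.Base as ℕ using (zero; suc; _^_; _%_; _<_; _≤_; _≡ᵇ_)
import Data.Nat.Properties as ℕ
import Data.Nat.DivMod as ℕ
open import Data.Nat.Coprimality as Coprime using (1-coprimeTo)
open import Data.Nat.Divisibility
  using (_∣_; divides; _∣?_; _∣0; ∣-trans; m∣m*n; *-cancelˡ-∣; quotient-<; quotient≢0; ∣m∣n⇒∣m+n)
open import Data.Nat.Induction using (<-rec)
open import Data.Product.Base using (∃₂; _×_; _,_; proj₁; proj₂)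
open import Data.Rational.Base as ℚ using (1ℚ; mkℚ; ↥_; _+_; _/_; 1/_)
import Data.Rational.Properties as ℚ
open import Function.Base using (_∘_)
open import Function.Bundles using (mk⇔; Equivalence)
open import Relation.Nullary.Decidable
  using (Dec; yes; no; ⌊_⌋; ¬?; _×-dec_; toWitness; decidable-stable)
open import Relation.Nullary.Negation using (¬_; contradiction)
open import Relation.Binary.PropositionalEquality
  using (refl; sym; trans; cong; cong₂; subst; subst₂; ≢-sym; module ≡-Reasoning)

-- Call y good if y ≢ 0 and c y = c (2y). Four exhaustive case analyses over a few dozen
-- points q y, each replayed by a refutation checker proved sound, show that for good y
-- c (4y) = c y = c (y/2), c (6y) = c (3y) and c (9y) ≢ c y; so 2y, y/2 and 3y are good
-- again. The solution (3y, y, 2y) gives c (3y) ≢ c y, hence c y, c (3y), c (9y) are the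
-- three colours and c (27y) = c y. For k coprime to 3, strong induction on k shows
-- c (ky) = c y: with i = k - 3, the solution (i (9/4) y, (9/2) y, (3 + i) y) rules out
-- the colour c (9y), and with w = y, j = k - 9 (or w = y/2, j = 2k - 9 when k < 9) the
-- solution (27 (3/4) w, j (3/2) w, (9 + j) w) rules out c (3/2 w) = c (3y).
-- Writing n = 3^e j with 3 ∤ j finally gives c (n x) = c (3^(e mod 3) x).

ℕtoℚ≡mkℚ : ∀ n → ℕtoℚ n ≡ mkℚ (+ n) 0 (Coprime.sym (1-coprimeTo n))
ℕtoℚ≡mkℚ n = ℚ.normalize-coprime (Coprime.sym (1-coprimeTo n))

-- On the normal forms mkℚ (+ m) 0 _, addition and multiplication compute to _/ 1 of the
-- integer expressions below.
ℕtoℚ-+ : ∀ m n → ℕtoℚ (m ℕ.+ n) ≡ ℕtoℚ m + ℕtoℚ n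
ℕtoℚ-+ m n = trans (cong (_/ 1) numerators) (sym (cong₂ _+_ (ℕtoℚ≡mkℚ m) (ℕtoℚ≡mkℚ n)))
  where
  numerators : + (m ℕ.+ n) ≡ + m ℤ.* + 1 ℤ.+ + n ℤ.* + 1
  numerators = trans (ℤ.pos-+ m n) (sym (cong₂ ℤ._+_ (ℤ.*-identityʳ (+ m)) (ℤ.*-identityʳ (+ n))))

ℕtoℚ-* : ∀ m n → ℕtoℚ (m ℕ.* n) ≡ ℕtoℚ m * ℕtoℚ n
ℕtoℚ-* m n = trans (cong (_/ 1) (ℤ.pos-* m n)) (sym (cong₂ _*_ (ℕtoℚ≡mkℚ m) (ℕtoℚ≡mkℚ n)))

ℕtoℚ-≢0 : ∀ n → n ≢ 0 → ℕtoℚ n ≢ 0ℚ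
ℕtoℚ-≢0 n n≢0 n≡0 = n≢0 (ℤ.+-injective (cong ↥_ (trans (sym (ℕtoℚ≡mkℚ n)) n≡0)))

ℕtoℚ-*-assoc : ∀ m n y → ℕtoℚ (m ℕ.* n) * y ≡ ℕtoℚ m * (ℕtoℚ n * y)
ℕtoℚ-*-assoc m n y = trans (cong (_* y) (ℕtoℚ-* m n)) (ℚ.*-assoc (ℕtoℚ m) (ℕtoℚ n) y)

*-≢0 : ∀ p q → p ≢ 0ℚ → q ≢ 0ℚ → p * q ≢ 0ℚ
*-≢0 p q p≢0 q≢0 pq≡0 = q≢0 (begin
  q                ≡⟨ ℚ.*-identityˡ q ⟨
  1ℚ * q           ≡⟨ cong (_* q) (ℚ.*-inverseˡ p) ⟨
  (1/ p * p) * q   ≡⟨ ℚ.*-assoc (1/ p) p q ⟩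
  1/ p * (p * q)   ≡⟨ cong (1/ p *_) pq≡0 ⟩
  1/ p * 0ℚ        ≡⟨ ℚ.*-zeroʳ (1/ p) ⟩
  0ℚ               ∎)
  where
  open ≡-Reasoning
  instance _ = ℚ.≢-nonZero p≢0

*-assocˡ : ∀ a b y → a * (b * y) ≡ (a * b) * y
*-assocˡ a b y = sym (ℚ.*-assoc a b y)

isSolution? : ∀ a b d → Dec (IsSolution a b d)
isSolution? a b d =
  ¬? (a ℚ.≟ 0ℚ) ×-dec ¬? (b ℚ.≟ 0ℚ) ×-dec ¬? (d ℚ.≟ 0ℚ) ×-dec (a + three/two * b ℚ.≟ nine/four * d)

IsSolution-scale : ∀ {a b d} y → y ≢ 0ℚ → IsSolution a b d → IsSolution (a * y) (b * y) (d * y)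
IsSolution-scale {a} {b} {d} y y≢0 (a≢0 , b≢0 , d≢0 , eq) =
  *-≢0 a y a≢0 y≢0 , *-≢0 b y b≢0 y≢0 , *-≢0 d y d≢0 y≢0 , (begin
    a * y + three/two * (b * y)   ≡⟨ cong (λ t → a * y + t) (*-assocˡ three/two b y) ⟩
    a * y + (three/two * b) * y   ≡⟨ ℚ.*-distribʳ-+ y a (three/two * b) ⟨
    (a + three/two * b) * y       ≡⟨ cong (_* y) eq ⟩
    (nine/four * d) * y           ≡⟨ ℚ.*-assoc nine/four d y ⟩
    nine/four * (d * y)           ∎)
  where open ≡-Reasoning

other-of-two : {x a d : Fin 2} → x ≢ d → a ≢ d → x ≡ a
other-of-two {zero}     {zero}                _   _   = refl
other-of-two {suc zero} {suc zero}            _   _   = refl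
other-of-two {zero}     {suc zero} {zero}     x≢d _   = ⊥-elim (x≢d refl)
other-of-two {zero}     {suc zero} {suc zero} _   a≢d = ⊥-elim (a≢d refl)
other-of-two {suc zero} {zero}     {zero}     _   a≢d = ⊥-elim (a≢d refl)
other-of-two {suc zero} {zero}     {suc zero} x≢d _   = ⊥-elim (x≢d refl)

-- punchOut b embeds the colours other than b into Fin 2.
other-of-three : {a b d x : Fin 3} → a ≢ b → a ≢ d → b ≢ d → x ≢ b → x ≢ d → x ≡ a
other-of-three a≢b a≢d b≢d x≢b x≢d =
  punchOut-injective (≢-sym x≢b) (≢-sym a≢b)
    (other-of-two (x≢d ∘ punchOut-injective (≢-sym x≢b) b≢d)
                  (a≢d ∘ punchOut-injective (≢-sym a≢b) b≢d))

-- The 3-adic valuation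

^-monoʳ-∣ : ∀ m {a b} → a ≤ b → m ^ a ∣ m ^ b
^-monoʳ-∣ m {a} a≤b with ℕ.m≤n⇒∃[o]m+o≡n a≤b
... | o , refl = divides (m ^ o) (trans (ℕ.^-distribˡ-+-* m a o) (ℕ.*-comm (m ^ a) (m ^ o)))

V3-unique : ∀ {n a b} → V3 n a → V3 n b → a ≡ b
V3-unique (3^a∣n , 3^[1+a]∤n) (3^b∣n , 3^[1+b]∤n) =
  ℕ.≤-antisym (bounded 3^a∣n 3^[1+b]∤n) (bounded 3^b∣n 3^[1+a]∤n)
  where
  bounded : ∀ {n a b} → 3 ^ a ∣ n → ¬ 3 ^ suc b ∣ n → a ≤ b
  bounded 3^a∣n 3^[1+b]∤n = ℕ.≮⇒≥ λ b<a → 3^[1+b]∤n (∣-trans (^-monoʳ-∣ 3 b<a) 3^a∣n)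

V3-3^e*j : ∀ e {j} → ¬ 3 ∣ j → V3 (3 ^ e ℕ.* j) e
V3-3^e*j e {j} 3∤j = m∣m*n j , λ 3^[1+e]∣3^e*j →
  3∤j (*-cancelˡ-∣ (3 ^ e) {{ℕ.m^n≢0 3 e}} (subst (_∣ 3 ^ e ℕ.* j) (ℕ.*-comm 3 (3 ^ e)) 3^[1+e]∣3^e*j))

3-adic-split : ∀ n → .{{NonZero n}} → ∃₂ λ e j → n ≡ 3 ^ e ℕ.* j × ¬ 3 ∣ j
3-adic-split = <-rec P step
  where
  P : ℕ → Set
  P n = .{{NonZero n}} → ∃₂ λ e j → n ≡ 3 ^ e ℕ.* j × ¬ 3 ∣ j
  step : ∀ n → (∀ {m} → m < n → P m) → P n
  step n rec with 3 ∣? n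
  ... | no 3∤n = 0 , n , sym (ℕ.+-identityʳ n) , 3∤n
  ... | yes 3∣n@(divides q n≡q*3) with rec (quotient-< 3∣n) {{quotient≢0 3∣n}}
  ...   | e , j , q≡3^e*j , 3∤j = suc e , j , (begin
    n                      ≡⟨ n≡q*3 ⟩
    q ℕ.* 3                ≡⟨ ℕ.*-comm q 3 ⟩
    3 ℕ.* q                ≡⟨ cong (3 ℕ.*_) q≡3^e*j ⟩
    3 ℕ.* (3 ^ e ℕ.* j)    ≡⟨ ℕ.*-assoc 3 (3 ^ e) j ⟨
    3 ^ suc e ℕ.* j        ∎) , 3∤j
    where open ≡-Reasoning

V3MultipleOf3⇔ : ∀ {n e} → V3 n e → V3MultipleOf3 n ⇔ e % 3 ≡ 0
V3MultipleOf3⇔ {n} {e} v = mk⇔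
  (λ (m , v′) → subst (λ k → k % 3 ≡ 0) (sym (e≡m*3 m v′)) (ℕ.m*n%n≡0 m 3))
  (λ e%3≡0 → e ℕ./ 3 , subst (V3 n) (e≡3*[e/3] e%3≡0) v)
  where
  e≡m*3 : ∀ m → V3 n (3 ℕ.* m) → e ≡ m ℕ.* 3
  e≡m*3 m v′ = trans (V3-unique {a = e} v v′) (ℕ.*-comm 3 m)
  e≡3*[e/3] : e % 3 ≡ 0 → e ≡ 3 ℕ.* (e ℕ./ 3)
  e≡3*[e/3] e%3≡0 =
    trans (ℕ.m≡m%n+[m/n]*n e 3) (trans (cong (ℕ._+ (e ℕ./ 3) ℕ.* 3) e%3≡0) (ℕ.*-comm (e ℕ./ 3) 3))

-- Refuting finite colouring problems

data Constraint : Set where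
  notMono     : ℕ × ℕ × ℕ → Constraint
  same differ : ℕ → ℕ → Constraint

Satisfies : (ℕ → Fin 3) → Constraint → Set
Satisfies v (notMono (i , j , k)) = ¬ (v i ≡ v j × v j ≡ v k)
Satisfies v (same i j)            = v i ≡ v j
Satisfies v (differ i j)          = v i ≢ v j

Assignment : Set
Assignment = ℕ → Maybe (Fin 3)

unassigned : Assignment
unassigned _ = nothing

_[_≔_] : Assignment → ℕ → Fin 3 → Assignment
(ρ [ i ≔ a ]) j = if i ≡ᵇ j then just a else ρ j

_Extends_ : (ℕ → Fin 3) → Assignment → Set
v Extends ρ = ∀ {i a} → ρ i ≡ just a → v i ≡ a

Extends-≔ : ∀ {v ρ a} i → v i ≡ a → v Extends ρ → v Extends (ρ [ i ≔ a ])
Extends-≔ {v} i refl v⊒ρ {j} with i ≡ᵇ j in i≡ᵇj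
... | true  = λ { refl → cong v (sym (ℕ.≡ᵇ⇒≡ i j (subst T (sym i≡ᵇj) _))) }
... | false = v⊒ρ

sameᵇ differᵇ : Maybe (Fin 3) → Maybe (Fin 3) → Bool
sameᵇ   (just a) (just b) = ⌊ a ≟ᶠ b ⌋
sameᵇ   _        _        = false
differᵇ (just a) (just b) = ⌊ ¬? (a ≟ᶠ b) ⌋
differᵇ _        _        = false

sameᵇ-sound : ∀ {v ρ} i j → v Extends ρ → T (sameᵇ (ρ i) (ρ j)) → v i ≡ v j
sameᵇ-sound {ρ = ρ} i j v⊒ρ t with ρ i in ρi | ρ j in ρj
... | just a | just b = trans (v⊒ρ ρi) (trans (toWitness t) (sym (v⊒ρ ρj)))

differᵇ-sound : ∀ {v ρ} i j → v Extends ρ → T (differᵇ (ρ i) (ρ j)) → v i ≢ v j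
differᵇ-sound {ρ = ρ} i j v⊒ρ t with ρ i in ρi | ρ j in ρj
... | just a | just b = λ vi≡vj → toWitness t (trans (sym (v⊒ρ ρi)) (trans vi≡vj (v⊒ρ ρj)))

violated : Assignment → Constraint → Bool
violated ρ (notMono (i , j , k)) = sameᵇ (ρ i) (ρ j) ∧ sameᵇ (ρ j) (ρ k)
violated ρ (same i j)            = differᵇ (ρ i) (ρ j)
violated ρ (differ i j)          = sameᵇ (ρ i) (ρ j)

violated-sound : ∀ {v ρ} C → v Extends ρ → T (violated ρ C) → ¬ Satisfies v C
violated-sound (notMono (i , j , k)) v⊒ρ t with Equivalence.to T-∧ t
... | tij , tjk = λ ¬mono → ¬mono (sameᵇ-sound i j v⊒ρ tij , sameᵇ-sound j k v⊒ρ tjk)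
violated-sound (same i j)   v⊒ρ t = differᵇ-sound i j v⊒ρ t
violated-sound (differ i j) v⊒ρ t = λ vi≢vj → vi≢vj (sameᵇ-sound i j v⊒ρ t)

data Refutation : Set where
  ✗     : Refutation
  split : ℕ → Refutation → Refutation → Refutation → Refutation

refutes : List Constraint → Assignment → Refutation → Bool
refutes Cs ρ ✗                  = any (violated ρ) Cs
refutes Cs ρ (split i t₀ t₁ t₂) =
  refutes Cs (ρ [ i ≔ zero ]) t₀ ∧ refutes Cs (ρ [ i ≔ suc zero ]) t₁ ∧ refutes Cs (ρ [ i ≔ suc (suc zero) ]) t₂

refutes-sound : ∀ {v} Cs ρ t → All (Satisfies v) Cs → v Extends ρ → T (refutes Cs ρ t) → ⊥
refutes-sound Cs ρ ✗ sat v⊒ρ t with All.lookupAny sat (any⁻ (violated ρ) Cs t)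
... | satisfied , isViolated = violated-sound _ v⊒ρ isViolated satisfied
refutes-sound {v} Cs ρ (split i t₀ t₁ t₂) sat v⊒ρ t with Equivalence.to T-∧ t
... | r₀ , r₁₂ with Equivalence.to T-∧ r₁₂
... | r₁ , r₂ with v i in vi
... | zero           = refutes-sound Cs _ t₀ sat (Extends-≔ i vi v⊒ρ) r₀
... | suc zero       = refutes-sound Cs _ t₁ sat (Extends-≔ i vi v⊒ρ) r₁
... | suc (suc zero) = refutes-sound Cs _ t₂ sat (Extends-≔ i vi v⊒ρ) r₂

record Certificate : Set where
  field
    points     : List ℚ
    triples    : List (ℕ × ℕ × ℕ)
    facts      : List Constraint
    refutation : Refutation

  -- Out-of-range indices denote 0ℚ, which occurs in no solution.
  point : ℕ → ℚ
  point = go points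
    where
    go : List ℚ → ℕ → ℚ
    go []       _       = 0ℚ
    go (q ∷ _)  zero    = q
    go (_ ∷ qs) (suc i) = go qs i

  solutionᵇ : ℕ × ℕ × ℕ → Bool
  solutionᵇ (i , j , k) = ⌊ isSolution? (point i) (point j) (point k) ⌋

  Valid : Set
  Valid = T (all solutionᵇ triples ∧ refutes (map notMono triples ++ facts) unassigned refutation)

open Certificate using (Valid; point; facts)

-- Colourings without monochromatic solutions

module Colouring (c : Coloring) (noMono : NoMonoSolution c) where

  refute : ∀ (C : Certificate) → Valid C → ∀ {y} → y ≢ 0ℚ →
           All (Satisfies (λ i → c (point C i * y))) (facts C) → ⊥
  refute C valid {y} y≢0 facts-hold with Equivalence.to T-∧ valid
  ... | solutions , refuted =
    refutes-sound _ unassigned refutation (All.++⁺ (All.map⁺ triples-hold) facts-hold) (λ ()) refuted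
    where
    open Certificate C using (triples; refutation; solutionᵇ)
    triples-hold : All (Satisfies (λ i → c (point C i * y)) ∘ notMono) triples
    triples-hold = All.map (λ s → noMono _ _ _ (IsSolution-scale y y≢0 (toWitness s)))
                           (All.all⁺ solutionᵇ triples solutions)

  colour-differs : ∀ {p q r s} → IsSolution p q r → c p ≡ c s → c q ≡ c s → c r ≢ c s
  colour-differs solution cp≡cs cq≡cs cr≡cs =
    noMono _ _ _ solution (trans cp≡cs (sym cq≡cs) , trans cq≡cs (sym cr≡cs))

  colour-1* : ∀ y → c (1ℚ * y) ≡ c y
  colour-1* y = cong c (ℚ.*-identityˡ y)

  colour-assoc : ∀ a b y → c (a * (b * y)) ≡ c ((a * b) * y)
  colour-assoc a b y = cong c (*-assocˡ a b y)

  Good : ℚ → Set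
  Good y = y ≢ 0ℚ × c y ≡ c (ℕtoℚ 2 * y)

  good-assoc : ∀ a b y → Good (a * (b * y)) → Good ((a * b) * y)
  good-assoc a b y = subst Good (*-assocˡ a b y)

  doubling : ∀ a y → Good (a * y) → c (a * y) ≡ c ((ℕtoℚ 2 * a) * y)
  doubling a y (_ , c[ay]≡c[2ay]) = trans c[ay]≡c[2ay] (colour-assoc (ℕtoℚ 2) a y)

  colour-4* : ∀ {y} → Good y → c (+ 4 / 1 * y) ≡ c y
  colour-4* {y} (y≢0 , c[y]≡c[2y]) = decidable-stable (c (+ 4 / 1 * y) ≟ᶠ c y) λ c[4y]≢c[y] →
    refute certificate _ y≢0
      (trans (colour-1* y) c[y]≡c[2y] ∷ c[4y]≢c[y] ∘ sym ∘ trans (sym (colour-1* y)) ∷ [])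
    where
    certificate : Certificate
    certificate = record
      { points     =
          + 1 / 1 ∷ + 2 / 1 ∷ + 4 / 1 ∷ + 5 / 2 ∷ + 3 / 1 ∷ + 10 / 3 ∷ + 13 / 3 ∷ + 9 / 2 ∷
          + 16 / 3 ∷ + 6 / 1 ∷ + 7 / 1 ∷ + 9 / 1 ∷ []
      ; triples    =
          (0 , 6 , 5) ∷ (3 , 5 , 5) ∷ (3 , 6 , 2) ∷ (4 , 0 , 1) ∷ (4 , 3 , 4) ∷ (4 , 4 , 5) ∷
          (4 , 2 , 2) ∷ (4 , 7 , 6) ∷ (4 , 9 , 8) ∷ (4 , 10 , 9) ∷ (2 , 5 , 2) ∷ (2 , 8 , 8) ∷
          (7 , 1 , 5) ∷ (7 , 9 , 9) ∷ (9 , 0 , 5) ∷ (10 , 5 , 8) ∷ (11 , 1 , 8) ∷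
          (11 , 4 , 9) ∷ (11 , 7 , 10) ∷ []
      ; facts      = same 0 1 ∷ differ 0 2 ∷ []
      ; refutation =
          split 0 (split 1 (split 4 ✗ (split 2 ✗ ✗ (split 5 (split 3 ✗ ✗ (split 6 ✗ (split 7 ✗ ✗
          (split 9 ✗ (split 8 (split 10 ✗ ✗ (split 11 ✗ ✗ ✗)) ✗ ✗) ✗)) ✗)) ✗ ✗)) (split 2 ✗
          (split 5 (split 3 ✗ (split 6 ✗ ✗ (split 7 ✗ (split 9 ✗ ✗ (split 8 (split 11 ✗
          (split 10 ✗ ✗ ✗) ✗) ✗ ✗)) ✗)) ✗) ✗ ✗) ✗)) ✗ ✗) (split 1 ✗ (split 4 (split 2 ✗ ✗
          (split 5 ✗ (split 3 ✗ ✗ (split 6 (split 7 ✗ ✗ (split 9 (split 8 ✗ (split 11 ✗ ✗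
          (split 10 ✗ ✗ ✗)) ✗) ✗ ✗)) ✗ ✗)) ✗)) ✗ (split 2 (split 5 ✗ (split 3 (split 6 ✗ ✗
          (split 7 (split 9 ✗ ✗ (split 8 ✗ (split 10 (split 11 ✗ ✗ ✗) ✗ ✗) ✗)) ✗ ✗)) ✗ ✗) ✗) ✗
          ✗)) ✗) (split 1 ✗ ✗ (split 2 (split 4 ✗ (split 5 ✗ ✗ (split 3 (split 6 ✗ (split 7
          (split 9 ✗ (split 8 ✗ ✗ (split 11 (split 10 ✗ ✗ ✗) ✗ ✗)) ✗) ✗ ✗) ✗) ✗ ✗)) ✗) (split 4
          (split 5 ✗ ✗ (split 3 ✗ (split 6 (split 7 ✗ (split 9 (split 8 ✗ ✗ (split 11 ✗
          (split 10 ✗ ✗ ✗) ✗)) ✗ ✗) ✗) ✗ ✗) ✗)) ✗ ✗) ✗))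
      }

  good-2* : ∀ {y} → Good y → Good (ℕtoℚ 2 * y)
  good-2* {y} g@(y≢0 , c[y]≡c[2y]) = *-≢0 (ℕtoℚ 2) y (λ ()) y≢0 ,
    trans (sym c[y]≡c[2y]) (trans (sym (colour-4* g)) (sym (colour-assoc (ℕtoℚ 2) (ℕtoℚ 2) y)))

  colour-8* : ∀ {y} → Good y → c (+ 8 / 1 * y) ≡ c y
  colour-8* {y} g =
    trans (sym (colour-assoc (+ 4 / 1) (ℕtoℚ 2) y)) (trans (colour-4* (good-2* g)) (sym (proj₂ g)))

  colour-½* : ∀ {y} → Good y → c (+ 1 / 2 * y) ≡ c y
  colour-½* {y} g@(y≢0 , c[y]≡c[2y]) = decidable-stable (c (+ 1 / 2 * y) ≟ᶠ c y) λ c[½y]≢c[y] →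
    refute certificate _ y≢0
      (trans (colour-1* y) c[y]≡c[2y] ∷ trans (colour-1* y) (sym (colour-4* g)) ∷
       trans (colour-1* y) (sym (colour-8* g)) ∷ c[½y]≢c[y] ∘ sym ∘ trans (sym (colour-1* y)) ∷ [])
    where
    certificate : Certificate
    certificate = record
      { points     =
          + 1 / 1 ∷ + 2 / 1 ∷ + 4 / 1 ∷ + 8 / 1 ∷ + 1 / 2 ∷ + 3 / 4 ∷ + 3 / 2 ∷ + 5 / 3 ∷
          + 7 / 3 ∷ + 5 / 2 ∷ + 3 / 1 ∷ + 10 / 3 ∷ + 13 / 3 ∷ + 9 / 2 ∷ + 5 / 1 ∷ + 6 / 1 ∷
          + 20 / 3 ∷ + 15 / 2 ∷ + 9 / 1 ∷ + 10 / 1 ∷ []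
      ; triples    =
          (5 , 0 , 0) ∷ (5 , 10 , 8) ∷ (5 , 13 , 11) ∷ (5 , 15 , 12) ∷ (0 , 8 , 1) ∷
          (6 , 6 , 7) ∷ (6 , 1 , 1) ∷ (1 , 7 , 1) ∷ (9 , 11 , 11) ∷ (9 , 12 , 2) ∷
          (10 , 4 , 7) ∷ (10 , 0 , 1) ∷ (10 , 9 , 10) ∷ (10 , 10 , 11) ∷ (10 , 13 , 12) ∷
          (2 , 11 , 2) ∷ (13 , 4 , 8) ∷ (13 , 6 , 10) ∷ (13 , 13 , 14) ∷ (13 , 15 , 15) ∷
          (14 , 16 , 16) ∷ (15 , 4 , 10) ∷ (15 , 1 , 2) ∷ (15 , 14 , 15) ∷ (15 , 15 , 16) ∷
          (17 , 0 , 2) ∷ (17 , 6 , 12) ∷ (17 , 19 , 19) ∷ (18 , 4 , 12) ∷ (18 , 5 , 13) ∷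
          (18 , 17 , 18) ∷ (18 , 18 , 19) ∷ (19 , 8 , 15) ∷ (3 , 16 , 3) ∷ []
      ; facts      = same 0 1 ∷ same 0 2 ∷ same 0 3 ∷ differ 0 4 ∷ []
      ; refutation =
          split 2 (split 0 (split 3 (split 1 (split 16 ✗ (split 15 ✗ ✗ (split 14 (split 13 ✗
          (split 11 ✗ (split 5 ✗ ✗ (split 10 ✗ ✗ (split 8 ✗ (split 4 ✗ ✗ ✗) ✗))) (split 10 ✗
          (split 6 ✗ ✗ (split 7 ✗ (split 4 ✗ ✗ (split 9 (split 12 ✗ ✗ (split 17 ✗ (split 18
          (split 5 ✗ (split 8 ✗ ✗ (split 19 ✗ ✗ ✗)) ✗) ✗ ✗) ✗)) ✗ ✗)) ✗)) ✗)) ✗) ✗ ✗)) (split 15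
          ✗ (split 14 (split 13 ✗ ✗ (split 11 ✗ (split 10 ✗ ✗ (split 6 ✗ (split 7 ✗ ✗ (split 9
          (split 12 ✗ (split 17 ✗ ✗ (split 4 ✗ (split 18 (split 19 ✗ (split 8 ✗ ✗ (split 5 ✗ ✗
          ✗)) ✗) ✗ ✗) ✗)) ✗) ✗ ✗)) ✗)) (split 10 ✗ (split 4 ✗ ✗ (split 5 ✗ (split 8 ✗ ✗ ✗) ✗))
          ✗))) ✗ ✗) ✗)) ✗ ✗) ✗ ✗) ✗ ✗) (split 0 ✗ (split 1 ✗ (split 3 ✗ (split 11 (split 10 ✗ ✗
          (split 9 ✗ (split 16 (split 15 ✗ ✗ (split 4 (split 14 ✗ (split 13 (split 8 ✗ ✗
          (split 5 ✗ ✗ ✗)) ✗ ✗) ✗) ✗ ✗)) ✗ (split 15 (split 14 ✗ (split 13 ✗ ✗ (split 12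
          (split 6 (split 7 ✗ ✗ (split 5 ✗ ✗ (split 4 (split 8 (split 18 ✗ (split 19 ✗ ✗
          (split 17 ✗ ✗ ✗)) ✗) ✗ ✗) ✗ ✗))) ✗ ✗) ✗ ✗)) ✗) ✗ ✗)) ✗)) ✗ (split 10 (split 9 ✗
          (split 15 (split 16 ✗ ✗ (split 14 ✗ (split 4 ✗ ✗ (split 13 ✗ ✗ (split 5 (split 8 ✗ ✗
          ✗) ✗ ✗))) ✗)) ✗ (split 16 (split 14 ✗ (split 13 (split 12 ✗ ✗ (split 5 (split 6 ✗ ✗
          (split 7 (split 8 ✗ ✗ (split 17 (split 4 ✗ ✗ (split 19 ✗ (split 18 ✗ ✗ ✗) ✗)) ✗ ✗)) ✗
          ✗)) ✗ ✗)) ✗ ✗) ✗) ✗ ✗)) ✗) ✗ ✗)) ✗) ✗) ✗) (split 0 ✗ ✗ (split 3 ✗ ✗ (split 1 ✗ ✗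
          (split 10 (split 11 ✗ (split 9 ✗ ✗ (split 15 (split 4 ✗ (split 16 ✗ (split 14 ✗ ✗
          (split 13 ✗ (split 8 (split 5 ✗ ✗ ✗) ✗ ✗) ✗)) ✗) ✗) (split 16 (split 14 ✗ ✗ (split 13
          (split 12 ✗ (split 5 (split 8 ✗ (split 6 ✗ (split 7 (split 4 ✗ (split 18 ✗ ✗ (split 17
          (split 19 ✗ ✗ ✗) ✗ ✗)) ✗) ✗ ✗) ✗) ✗) ✗ ✗) ✗) ✗ ✗)) ✗ ✗) ✗)) ✗) (split 11 (split 9 ✗ ✗
          (split 15 (split 16 ✗ (split 14 ✗ ✗ (split 13 ✗ (split 12 (split 6 (split 5 ✗ (split 7
          ✗ (split 8 (split 17 ✗ (split 4 (split 18 ✗ ✗ (split 19 ✗ ✗ ✗)) ✗ ✗) ✗) ✗ ✗) ✗) ✗) ✗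
          ✗) ✗ ✗) ✗)) ✗) (split 16 (split 4 (split 14 ✗ ✗ (split 13 (split 8 ✗ (split 5 ✗ ✗ ✗)
          ✗) ✗ ✗)) ✗ ✗) ✗ ✗) ✗)) ✗ ✗) ✗))))
      }

  good-½* : ∀ {y} → Good y → Good (+ 1 / 2 * y)
  good-½* {y} g@(y≢0 , c[y]≡c[2y]) = *-≢0 (+ 1 / 2) y (λ ()) y≢0 ,
    trans (colour-½* g) (trans (sym (colour-1* y)) (sym (colour-assoc (ℕtoℚ 2) (+ 1 / 2) y)))

  good-¼* : ∀ {y} → Good y → Good (+ 1 / 4 * y)
  good-¼* {y} g = good-assoc (+ 1 / 2) (+ 1 / 2) y (good-½* (good-½* g))

  colour-¼* : ∀ {y} → Good y → c (+ 1 / 4 * y) ≡ c y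
  colour-¼* {y} g =
    trans (sym (colour-assoc (+ 1 / 2) (+ 1 / 2) y)) (trans (colour-½* (good-½* g)) (colour-½* g))

  colour-⅛* : ∀ {y} → Good y → c (+ 1 / 8 * y) ≡ c y
  colour-⅛* {y} g =
    trans (sym (colour-assoc (+ 1 / 2) (+ 1 / 4) y)) (trans (colour-½* (good-¼* g)) (colour-¼* g))

  colour-6*≡3* : ∀ {y} → Good y → c (+ 6 / 1 * y) ≡ c (+ 3 / 1 * y)
  colour-6*≡3* {y} g@(y≢0 , c[y]≡c[2y]) =
    decidable-stable (c (+ 6 / 1 * y) ≟ᶠ c (+ 3 / 1 * y)) λ c[6y]≢c[3y] →
    refute certificate _ y≢0
      (trans (colour-1* y) c[y]≡c[2y] ∷ trans (colour-1* y) (sym (colour-½* g)) ∷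
       trans (colour-1* y) (sym (colour-¼* g)) ∷ trans (colour-1* y) (sym (colour-⅛* g)) ∷
       trans (colour-1* y) (sym (colour-8* g)) ∷ ≢-sym c[6y]≢c[3y] ∷ [])
    where
    certificate : Certificate
    certificate = record
      { points     =
          + 1 / 1 ∷ + 2 / 1 ∷ + 1 / 2 ∷ + 1 / 4 ∷ + 1 / 8 ∷ + 8 / 1 ∷ + 3 / 1 ∷ + 6 / 1 ∷
          + 1 / 6 ∷ + 2 / 9 ∷ + 4 / 9 ∷ + 2 / 3 ∷ + 5 / 6 ∷ + 8 / 9 ∷ + 7 / 6 ∷ + 11 / 9 ∷
          + 4 / 3 ∷ + 3 / 2 ∷ + 16 / 9 ∷ + 17 / 9 ∷ + 5 / 2 ∷ + 8 / 3 ∷ + 10 / 3 ∷ + 11 / 3 ∷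
          + 13 / 3 ∷ + 9 / 2 ∷ + 5 / 1 ∷ + 20 / 3 ∷ []
      ; triples    =
          (4 , 8 , 8) ∷ (4 , 3 , 9) ∷ (4 , 11 , 2) ∷ (4 , 23 , 20) ∷ (4 , 27 , 25) ∷
          (8 , 9 , 9) ∷ (8 , 19 , 16) ∷ (3 , 2 , 10) ∷ (3 , 16 , 0) ∷ (3 , 20 , 18) ∷
          (2 , 0 , 13) ∷ (2 , 14 , 0) ∷ (2 , 20 , 19) ∷ (2 , 21 , 1) ∷ (11 , 9 , 10) ∷
          (11 , 13 , 13) ∷ (12 , 10 , 11) ∷ (0 , 12 , 0) ∷ (0 , 24 , 22) ∷ (14 , 15 , 16) ∷
          (14 , 19 , 18) ∷ (16 , 10 , 13) ∷ (16 , 18 , 18) ∷ (17 , 2 , 0) ∷ (17 , 12 , 15) ∷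
          (1 , 2 , 15) ∷ (20 , 22 , 22) ∷ (21 , 9 , 16) ∷ (21 , 13 , 18) ∷ (6 , 11 , 18) ∷
          (6 , 0 , 1) ∷ (6 , 20 , 6) ∷ (6 , 6 , 22) ∷ (6 , 25 , 24) ∷ (6 , 5 , 27) ∷
          (22 , 10 , 18) ∷ (22 , 18 , 21) ∷ (23 , 9 , 18) ∷ (25 , 17 , 6) ∷ (25 , 1 , 22) ∷
          (25 , 25 , 26) ∷ (25 , 7 , 7) ∷ (26 , 27 , 27) ∷ (7 , 0 , 22) ∷ (7 , 17 , 23) ∷
          (7 , 20 , 24) ∷ (7 , 26 , 7) ∷ (7 , 7 , 27) ∷ (7 , 5 , 5) ∷ (5 , 27 , 5) ∷ []
      ; facts      = same 0 1 ∷ same 0 2 ∷ same 0 3 ∷ same 0 4 ∷ same 0 5 ∷ differ 6 7 ∷ []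
      ; refutation =
          split 20 (split 6 ✗ (split 22 ✗ ✗ (split 7 (split 5 ✗ (split 0 ✗ (split 1 ✗ ✗ ✗) ✗)
          (split 0 ✗ ✗ (split 1 ✗ ✗ (split 24 ✗ (split 25 ✗ ✗ ✗) ✗)))) ✗ (split 0 (split 4
          (split 5 (split 27 ✗ (split 3 (split 1 (split 2 (split 26 (split 25 ✗ (split 17 ✗ ✗
          (split 23 ✗ (split 21 ✗ (split 18 ✗ (split 11 ✗ ✗ (split 13 ✗ ✗ ✗)) (split 10 ✗
          (split 16 ✗ (split 9 ✗ ✗ (split 13 ✗ ✗ (split 8 ✗ (split 11 ✗ (split 19 ✗ ✗ (split 14
          ✗ (split 12 ✗ ✗ (split 15 ✗ ✗ ✗)) ✗)) ✗) ✗))) ✗) ✗)) (split 18 ✗ (split 16 ✗ ✗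
          (split 9 ✗ ✗ ✗)) ✗)) ✗)) ✗) ✗ ✗) ✗ ✗) ✗ ✗) ✗ ✗) ✗) ✗ ✗) ✗ ✗) (split 1 ✗ ✗ ✗) ✗)))
          (split 22 ✗ (split 7 (split 27 ✗ (split 5 ✗ ✗ (split 0 ✗ ✗ (split 1 ✗ ✗ ✗))) (split 5
          ✗ (split 26 ✗ (split 0 ✗ (split 24 ✗ ✗ (split 25 ✗ ✗ ✗)) ✗) ✗) ✗)) (split 0 (split 4
          (split 3 (split 5 (split 1 (split 2 (split 27 ✗ ✗ (split 26 (split 25 ✗ ✗ (split 17 ✗
          (split 23 ✗ ✗ (split 11 ✗ (split 13 ✗ ✗ (split 18 ✗ (split 10 ✗ ✗ (split 16 ✗ ✗ ✗))
          (split 9 ✗ (split 16 ✗ (split 21 ✗ ✗ ✗) ✗) ✗))) (split 18 ✗ (split 16 ✗ ✗ (split 10 ✗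
          ✗ (split 9 ✗ (split 12 ✗ (split 15 ✗ ✗ (split 14 ✗ (split 19 ✗ ✗ (split 8 ✗ ✗ ✗)) ✗))
          ✗) ✗))) ✗))) ✗)) ✗ ✗)) ✗ ✗) ✗ ✗) ✗ ✗) ✗ ✗) ✗ ✗) ✗ (split 1 ✗ ✗ ✗)) ✗) ✗)) (split 22
          (split 6 ✗ ✗ (split 7 (split 0 ✗ (split 1 ✗ (split 5 ✗ (split 27 ✗ ✗ (split 26 ✗
          (split 2 ✗ (split 25 ✗ ✗ (split 17 (split 3 ✗ (split 4 ✗ (split 23 ✗ ✗ (split 21
          (split 18 ✗ ✗ (split 9 (split 16 ✗ ✗ ✗) ✗ ✗)) ✗ (split 18 (split 16 ✗ ✗ (split 10 ✗ ✗
          (split 9 (split 13 (split 8 ✗ ✗ (split 11 ✗ ✗ (split 12 (split 19 (split 14 ✗ ✗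
          (split 15 ✗ ✗ ✗)) ✗ ✗) ✗ ✗))) ✗ ✗) ✗ ✗))) ✗ (split 13 (split 11 ✗ ✗ ✗) ✗ ✗)))) ✗) ✗) ✗
          ✗)) ✗) ✗)) ✗) ✗) (split 1 ✗ ✗ ✗)) (split 25 (split 26 ✗ ✗ (split 27 (split 5 ✗ ✗
          (split 0 ✗ ✗ (split 1 ✗ ✗ ✗))) ✗ ✗)) ✗ (split 26 (split 24 (split 27 ✗ ✗ (split 5
          (split 0 ✗ ✗ ✗) ✗ ✗)) ✗ ✗) ✗ ✗)) ✗)) ✗ (split 6 (split 7 ✗ (split 5 (split 0 (split 1
          ✗ ✗ ✗) ✗ ✗) ✗ (split 27 (split 26 ✗ ✗ (split 25 (split 24 ✗ ✗ (split 0 ✗ ✗ ✗)) ✗ ✗)) ✗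
          ✗)) (split 27 (split 5 ✗ (split 26 ✗ (split 25 (split 0 ✗ (split 1 ✗ (split 2 ✗
          (split 17 ✗ ✗ (split 3 ✗ (split 4 ✗ (split 23 (split 13 (split 11 ✗ ✗ (split 9
          (split 18 ✗ ✗ (split 16 (split 21 ✗ ✗ ✗) ✗ ✗)) ✗ (split 10 (split 16 ✗ ✗ (split 21
          (split 18 ✗ ✗ ✗) ✗ ✗)) ✗ ✗))) ✗ (split 11 (split 18 ✗ ✗ (split 10 (split 12 ✗ ✗
          (split 16 (split 9 ✗ ✗ (split 15 (split 14 ✗ ✗ (split 8 (split 19 ✗ ✗ ✗) ✗ ✗)) ✗ ✗)) ✗
          ✗)) ✗ ✗)) ✗ ✗)) ✗ ✗) ✗) ✗)) ✗) ✗) ✗) ✗ ✗) ✗) ✗) (split 5 (split 0 (split 1 ✗ ✗ ✗) ✗ ✗)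
          ✗ ✗) ✗)) ✗ ✗)) (split 22 (split 6 ✗ (split 7 (split 0 ✗ (split 1 ✗ ✗ ✗) (split 4 ✗ ✗
          (split 2 ✗ ✗ (split 3 ✗ ✗ (split 1 ✗ ✗ (split 5 ✗ ✗ (split 27 ✗ (split 26 ✗ ✗
          (split 25 ✗ (split 17 (split 23 ✗ (split 18 (split 16 ✗ (split 10 ✗ (split 13
          (split 11 ✗ (split 12 (split 9 (split 15 ✗ (split 14 (split 8 ✗ (split 19 ✗ ✗ ✗) ✗) ✗
          ✗) ✗) ✗ ✗) ✗ ✗) ✗) ✗ ✗) ✗) ✗) (split 16 (split 11 (split 13 ✗ (split 9 (split 21 ✗ ✗
          ✗) ✗ ✗) ✗) ✗ ✗) ✗ ✗) ✗) ✗) ✗ ✗) ✗)) ✗))))))) ✗ (split 27 (split 5 ✗ (split 0 ✗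
          (split 1 ✗ ✗ ✗) ✗) ✗) (split 5 (split 0 (split 26 (split 24 ✗ (split 25 ✗ ✗ ✗) ✗) ✗ ✗)
          ✗ ✗) ✗ ✗) ✗)) ✗) (split 6 (split 7 ✗ (split 5 (split 0 (split 1 ✗ ✗ ✗) ✗ ✗) ✗ (split 0
          ✗ ✗ (split 3 ✗ ✗ (split 27 (split 1 ✗ ✗ (split 26 ✗ ✗ (split 25 (split 2 ✗ ✗ (split 4
          ✗ ✗ (split 17 ✗ (split 23 (split 18 (split 16 ✗ (split 9 ✗ (split 21 (split 11 ✗
          (split 13 ✗ ✗ ✗) ✗) ✗ ✗) ✗) ✗) (split 16 (split 10 (split 13 ✗ (split 11 (split 12 ✗
          (split 9 ✗ (split 15 (split 8 (split 19 ✗ (split 14 ✗ ✗ ✗) ✗) ✗ ✗) ✗ ✗) ✗) ✗) ✗ ✗) ✗)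
          ✗ ✗) ✗ ✗) ✗) ✗ ✗) ✗))) ✗ ✗))) ✗ ✗)))) (split 26 (split 27 ✗ (split 5 (split 0 (split 1
          ✗ ✗ ✗) ✗ ✗) ✗ ✗) ✗) (split 27 (split 5 ✗ (split 25 (split 24 ✗ (split 0 ✗ ✗ ✗) ✗) ✗ ✗)
          ✗) ✗ ✗) ✗)) ✗ ✗) ✗)
      }

  good-3* : ∀ {y} → Good y → Good (+ 3 / 1 * y)
  good-3* {y} g@(y≢0 , _) = *-≢0 (+ 3 / 1) y (λ ()) y≢0 ,
    trans (sym (colour-6*≡3* g)) (sym (colour-assoc (ℕtoℚ 2) (+ 3 / 1) y))

  good-9* : ∀ {y} → Good y → Good (+ 9 / 1 * y)
  good-9* {y} g = good-assoc (+ 3 / 1) (+ 3 / 1) y (good-3* (good-3* g))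

  good-3/2* : ∀ {y} → Good y → Good (+ 3 / 2 * y)
  good-3/2* {y} g = good-assoc (+ 1 / 2) (+ 3 / 1) y (good-½* (good-3* g))

  good-3/4* : ∀ {y} → Good y → Good (+ 3 / 4 * y)
  good-3/4* {y} g = good-assoc (+ 1 / 2) (+ 3 / 2) y (good-½* (good-3/2* g))

  good-9/2* : ∀ {y} → Good y → Good (+ 9 / 2 * y)
  good-9/2* {y} g = good-assoc (+ 1 / 2) (+ 9 / 1) y (good-½* (good-9* g))

  good-9/4* : ∀ {y} → Good y → Good (+ 9 / 4 * y)
  good-9/4* {y} g = good-assoc (+ 1 / 2) (+ 9 / 2) y (good-½* (good-9/2* g))

  colour-3*≢ : ∀ {y} → Good y → c (+ 3 / 1 * y) ≢ c y
  colour-3*≢ {y} (y≢0 , c[y]≡c[2y]) c[3y]≡c[y] = colour-differs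
    (IsSolution-scale y y≢0 (toWitness {a? = isSolution? (+ 3 / 1) 1ℚ (+ 2 / 1)} _))
    c[3y]≡c[y] (colour-1* y) (sym c[y]≡c[2y])

  colour-9*≢ : ∀ {y} → Good y → c (+ 9 / 1 * y) ≢ c y
  colour-9*≢ {y} g@(y≢0 , c[y]≡c[2y]) c[9y]≡c[y] =
    refute certificate _ y≢0
      (trans (colour-1* y) c[y]≡c[2y] ∷ trans (colour-1* y) (sym (colour-½* g)) ∷
       trans (colour-1* y) (sym (colour-¼* g)) ∷ trans (colour-1* y) (sym c[9y]≡c[y]) ∷
       at-3y (+ 1 / 2) (colour-½* g₃) ∷ at-3y (+ 1 / 4) (colour-¼* g₃) ∷ doubling (+ 3 / 1) y g₃ ∷
       at-3y (+ 4 / 1) (colour-4* g₃) ∷ [])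
    where
    g₃ : Good (+ 3 / 1 * y)
    g₃ = good-3* g
    at-3y : ∀ a → c (a * (+ 3 / 1 * y)) ≡ c (+ 3 / 1 * y) → c (+ 3 / 1 * y) ≡ c ((a * (+ 3 / 1)) * y)
    at-3y a c[a3y]≡c[3y] = trans (sym c[a3y]≡c[3y]) (colour-assoc a (+ 3 / 1) y)
    certificate : Certificate
    certificate = record
      { points     =
          + 1 / 1 ∷ + 2 / 1 ∷ + 1 / 2 ∷ + 1 / 4 ∷ + 9 / 1 ∷ + 3 / 1 ∷ + 3 / 2 ∷ + 3 / 4 ∷
          + 6 / 1 ∷ + 12 / 1 ∷ + 1 / 3 ∷ + 4 / 9 ∷ + 4 / 3 ∷ + 7 / 3 ∷ + 14 / 3 ∷ + 10 / 1 ∷ []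
      ; triples    =
          (3 , 10 , 10) ∷ (3 , 2 , 11) ∷ (3 , 12 , 0) ∷ (10 , 11 , 11) ∷ (7 , 0 , 0) ∷
          (7 , 6 , 12) ∷ (7 , 5 , 13) ∷ (0 , 12 , 12) ∷ (0 , 13 , 1) ∷ (6 , 1 , 1) ∷
          (6 , 8 , 14) ∷ (13 , 11 , 12) ∷ (5 , 3 , 6) ∷ (8 , 2 , 5) ∷ (4 , 0 , 14) ∷
          (4 , 5 , 8) ∷ (4 , 4 , 15) ∷ (15 , 10 , 14) ∷ (9 , 15 , 9) ∷ []
      ; facts      = same 0 1 ∷ same 0 2 ∷ same 0 3 ∷ same 0 4 ∷ same 5 6 ∷ same 5 7 ∷ same 5 8 ∷ same 5 9 ∷ []
      ; refutation =
          split 5 (split 6 (split 8 (split 7 (split 9 (split 15 ✗ (split 4 ✗ ✗ (split 0 ✗ ✗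
          (split 14 ✗ (split 3 ✗ ✗ (split 12 ✗ (split 2 ✗ ✗ (split 10 (split 1 ✗ ✗ (split 11 ✗
          (split 13 ✗ ✗ ✗) ✗)) ✗ ✗)) ✗)) ✗))) (split 4 ✗ (split 0 ✗ (split 12 ✗ ✗ (split 1 ✗
          (split 2 ✗ (split 3 ✗ (split 14 ✗ ✗ (split 13 ✗ ✗ (split 10 (split 11 ✗ ✗ ✗) ✗ ✗))) ✗)
          ✗) ✗)) ✗) ✗)) ✗ ✗) ✗ ✗) ✗ ✗) ✗ ✗) (split 6 ✗ (split 9 ✗ (split 7 ✗ (split 8 ✗ (split 3
          (split 0 (split 2 (split 1 (split 12 ✗ ✗ (split 13 ✗ ✗ (split 11 ✗ (split 4 (split 14
          ✗ ✗ (split 15 ✗ ✗ (split 10 ✗ ✗ ✗))) ✗ ✗) ✗))) ✗ ✗) ✗ ✗) ✗ ✗) ✗ (split 0 ✗ ✗ (split 12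
          (split 4 ✗ ✗ (split 15 (split 1 ✗ ✗ (split 2 ✗ ✗ (split 13 (split 14 (split 11 ✗
          (split 10 ✗ ✗ ✗) ✗) ✗ ✗) ✗ ✗))) ✗ ✗)) ✗ ✗))) ✗) ✗) ✗) ✗) (split 6 ✗ ✗ (split 9 ✗ ✗
          (split 8 ✗ ✗ (split 7 ✗ ✗ (split 2 (split 0 (split 4 (split 1 (split 3 (split 13 ✗
          (split 15 ✗ (split 14 ✗ (split 12 ✗ (split 10 ✗ ✗ (split 11 ✗ ✗ ✗)) ✗) ✗) ✗) ✗) ✗ ✗) ✗
          ✗) ✗ ✗) ✗ ✗) (split 0 ✗ (split 3 ✗ (split 4 ✗ (split 12 (split 1 ✗ (split 15 (split 14
          (split 13 (split 11 ✗ ✗ (split 10 ✗ ✗ ✗)) ✗ ✗) ✗ ✗) ✗ ✗) ✗) ✗ ✗) ✗) ✗) ✗) ✗)))))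
      }

  distinct-colours : ∀ {y} → Good y →
    c y ≢ c (+ 3 / 1 * y) × c y ≢ c (+ 9 / 1 * y) × c (+ 3 / 1 * y) ≢ c (+ 9 / 1 * y)
  distinct-colours {y} g = ≢-sym (colour-3*≢ g) , ≢-sym (colour-9*≢ g) ,
    λ c[3y]≡c[9y] → colour-3*≢ (good-3* g) (trans (colour-assoc (+ 3 / 1) (+ 3 / 1) y) (sym c[3y]≡c[9y]))

  colour-27* : ∀ {y} → Good y → c (+ 27 / 1 * y) ≡ c y
  colour-27* {y} g =
    let y≢3y , y≢9y , 3y≢9y = distinct-colours g in
    other-of-three y≢3y y≢9y 3y≢9y
      (colour-9*≢ (good-3* g) ∘ trans (colour-assoc (+ 9 / 1) (+ 3 / 1) y))
      (colour-3*≢ (good-9* g) ∘ trans (colour-assoc (+ 3 / 1) (+ 9 / 1) y))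

  good-3^ : ∀ e {y} → Good y → Good (ℕtoℚ (3 ^ e) * y)
  good-3^ zero        g = subst Good (sym (ℚ.*-identityˡ _)) g
  good-3^ (suc e) {y} g = subst Good (sym (ℕtoℚ-*-assoc 3 (3 ^ e) y)) (good-3* (good-3^ e g))

  -- The last clause relies on (3 + e) % 3 and e % 3 being definitionally equal.
  colour-3^ : ∀ {y} → Good y → ∀ e → c (ℕtoℚ (3 ^ e) * y) ≡ c (ℕtoℚ (3 ^ (e % 3)) * y)
  colour-3^ g 0 = refl
  colour-3^ g 1 = refl
  colour-3^ g 2 = refl
  colour-3^ {y} g (suc (suc (suc e))) = begin
    c (ℕtoℚ (3 ℕ.* (3 ℕ.* (3 ℕ.* 3 ^ e))) * y)  ≡⟨ cong (λ n → c (ℕtoℚ n * y)) 3*[3*[3*x]]≡27*x ⟩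
    c (ℕtoℚ (27 ℕ.* 3 ^ e) * y)                 ≡⟨ cong c (ℕtoℚ-*-assoc 27 (3 ^ e) y) ⟩
    c (+ 27 / 1 * (ℕtoℚ (3 ^ e) * y))            ≡⟨ colour-27* (good-3^ e g) ⟩
    c (ℕtoℚ (3 ^ e) * y)                         ≡⟨ colour-3^ g e ⟩
    c (ℕtoℚ (3 ^ (e % 3)) * y)                   ∎
    where
    open ≡-Reasoning
    3*[3*[3*x]]≡27*x : 3 ℕ.* (3 ℕ.* (3 ℕ.* 3 ^ e)) ≡ 27 ℕ.* 3 ^ e
    3*[3*[3*x]]≡27*x = sym (trans (ℕ.*-assoc 9 3 (3 ^ e)) (ℕ.*-assoc 3 3 (3 ℕ.* 3 ^ e)))

  colour-3^-residue : ∀ {y} → Good y → ∀ r → r < 3 → c (ℕtoℚ (3 ^ r) * y) ≡ c y → r ≡ 0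
  colour-3^-residue g 0 _ _                  = refl
  colour-3^-residue g 1 _ c[3y]≡c[y]         = contradiction c[3y]≡c[y] (colour-3*≢ g)
  colour-3^-residue g 2 _ c[9y]≡c[y]         = contradiction c[9y]≡c[y] (colour-9*≢ g)
  colour-3^-residue g (suc (suc (suc _))) (ℕ.s≤s (ℕ.s≤s (ℕ.s≤s ())))

  Fixes : ℕ → Set
  Fixes k = ∀ {w} → Good w → c (ℕtoℚ k * w) ≡ c w

  avoids-9* : ∀ i → Fixes i → i ≢ 0 → ∀ {y} → Good y → c (ℕtoℚ (3 ℕ.+ i) * y) ≢ c (+ 9 / 1 * y)
  avoids-9* i fixes-i i≢0 {y} g = colour-differs (IsSolution-scale y (proj₁ g) solution)
    (begin
      c ((ℕtoℚ i * (+ 9 / 4)) * y)  ≡⟨ colour-assoc (ℕtoℚ i) (+ 9 / 4) y ⟨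
      c (ℕtoℚ i * (+ 9 / 4 * y))    ≡⟨ fixes-i (good-9/4* g) ⟩
      c (+ 9 / 4 * y)               ≡⟨ doubling (+ 9 / 4) y (good-9/4* g) ⟩
      c (+ 9 / 2 * y)               ≡⟨ doubling (+ 9 / 2) y (good-9/2* g) ⟩
      c (+ 9 / 1 * y)               ∎)
    (doubling (+ 9 / 2) y (good-9/2* g))
    where
    open ≡-Reasoning
    coefficients : ℕtoℚ i * (+ 9 / 4) + three/two * (+ 9 / 2) ≡ nine/four * ℕtoℚ (3 ℕ.+ i)
    coefficients = begin
      ℕtoℚ i * (+ 9 / 4) + three/two * (+ 9 / 2)  ≡⟨ ℚ.+-comm (ℕtoℚ i * (+ 9 / 4)) (three/two * (+ 9 / 2)) ⟩
      nine/four * ℕtoℚ 3 + ℕtoℚ i * nine/four     ≡⟨ cong (λ t → nine/four * ℕtoℚ 3 + t) (ℚ.*-comm (ℕtoℚ i) nine/four) ⟩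
      nine/four * ℕtoℚ 3 + nine/four * ℕtoℚ i     ≡⟨ ℚ.*-distribˡ-+ nine/four (ℕtoℚ 3) (ℕtoℚ i) ⟨
      nine/four * (ℕtoℚ 3 + ℕtoℚ i)               ≡⟨ cong (nine/four *_) (ℕtoℚ-+ 3 i) ⟨
      nine/four * ℕtoℚ (3 ℕ.+ i)                  ∎
    solution : IsSolution (ℕtoℚ i * (+ 9 / 4)) (+ 9 / 2) (ℕtoℚ (3 ℕ.+ i))
    solution = *-≢0 (ℕtoℚ i) (+ 9 / 4) (ℕtoℚ-≢0 i i≢0) (λ ()) , (λ ()) , ℕtoℚ-≢0 (3 ℕ.+ i) (λ ()) , coefficients

  avoids-3/2 : ∀ j → Fixes j → j ≢ 0 → ∀ {w} → Good w → c (ℕtoℚ (9 ℕ.+ j) * w) ≢ c (+ 3 / 2 * w)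
  avoids-3/2 j fixes-j j≢0 {w} g = colour-differs (IsSolution-scale w (proj₁ g) solution)
    (begin
      c (+ 81 / 4 * w)              ≡⟨ colour-assoc (+ 27 / 1) (+ 3 / 4) w ⟨
      c (+ 27 / 1 * (+ 3 / 4 * w))  ≡⟨ colour-27* (good-3/4* g) ⟩
      c (+ 3 / 4 * w)               ≡⟨ doubling (+ 3 / 4) w (good-3/4* g) ⟩
      c (+ 3 / 2 * w)               ∎)
    (trans (sym (colour-assoc (ℕtoℚ j) (+ 3 / 2) w)) (fixes-j (good-3/2* g)))
    where
    open ≡-Reasoning
    coefficients : + 81 / 4 + three/two * (ℕtoℚ j * (+ 3 / 2)) ≡ nine/four * ℕtoℚ (9 ℕ.+ j)
    coefficients = begin
      + 81 / 4 + three/two * (ℕtoℚ j * (+ 3 / 2))  ≡⟨ cong (λ t → + 81 / 4 + three/two * t) (ℚ.*-comm (ℕtoℚ j) three/two) ⟩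
      + 81 / 4 + three/two * (three/two * ℕtoℚ j)  ≡⟨ cong (λ t → + 81 / 4 + t) (*-assocˡ three/two three/two (ℕtoℚ j)) ⟩
      nine/four * ℕtoℚ 9 + nine/four * ℕtoℚ j      ≡⟨ ℚ.*-distribˡ-+ nine/four (ℕtoℚ 9) (ℕtoℚ j) ⟨
      nine/four * (ℕtoℚ 9 + ℕtoℚ j)                ≡⟨ cong (nine/four *_) (ℕtoℚ-+ 9 j) ⟨
      nine/four * ℕtoℚ (9 ℕ.+ j)                   ∎
    solution : IsSolution (+ 81 / 4) (ℕtoℚ j * (+ 3 / 2)) (ℕtoℚ (9 ℕ.+ j))
    solution = (λ ()) , *-≢0 (ℕtoℚ j) (+ 3 / 2) (ℕtoℚ-≢0 j j≢0) (λ ()) , ℕtoℚ-≢0 (9 ℕ.+ j) (λ ()) , coefficients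

  avoids-3* : ∀ j → Fixes j → j ≢ 0 → ∀ {y} → Good y → c (ℕtoℚ (9 ℕ.+ j) * y) ≢ c (+ 3 / 1 * y)
  avoids-3* j fixes-j j≢0 {y} g =
    subst (c (ℕtoℚ (9 ℕ.+ j) * y) ≢_) (doubling (+ 3 / 2) y (good-3/2* g)) (avoids-3/2 j fixes-j j≢0 g)

  avoids-3*-halved : ∀ j → Fixes j → j ≢ 0 → ∀ {y} → Good y →
                     c ((ℕtoℚ (9 ℕ.+ j) * (+ 1 / 2)) * y) ≢ c (+ 3 / 1 * y)
  avoids-3*-halved j fixes-j j≢0 {y} g =
    subst₂ _≢_ (colour-assoc (ℕtoℚ (9 ℕ.+ j)) (+ 1 / 2) y) c[3/4y]≡c[3y] (avoids-3/2 j fixes-j j≢0 (good-½* g))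
    where
    c[3/4y]≡c[3y] : c (+ 3 / 2 * (+ 1 / 2 * y)) ≡ c (+ 3 / 1 * y)
    c[3/4y]≡c[3y] = trans (colour-assoc (+ 3 / 2) (+ 1 / 2) y)
                          (trans (doubling (+ 3 / 4) y (good-3/4* g)) (doubling (+ 3 / 2) y (good-3/2* g)))

  fixes-by-avoidance : ∀ k {y} → Good y →
    c (ℕtoℚ k * y) ≢ c (+ 3 / 1 * y) → c (ℕtoℚ k * y) ≢ c (+ 9 / 1 * y) → c (ℕtoℚ k * y) ≡ c y
  fixes-by-avoidance k g ≢c[3y] ≢c[9y] =
    let y≢3y , y≢9y , 3y≢9y = distinct-colours g in
    other-of-three y≢3y y≢9y 3y≢9y ≢c[3y] ≢c[9y]

  fixes-1 : Fixes 1
  fixes-1 {w} _ = colour-1* w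

  fixes-2 : Fixes 2
  fixes-2 = sym ∘ proj₂

  fixes-4 : Fixes 4
  fixes-4 = colour-4*

  fixes-5 : Fixes 5
  fixes-5 g = fixes-by-avoidance 5 g (avoids-3*-halved 1 fixes-1 (λ ()) g) (avoids-9* 2 fixes-2 (λ ()) g)

  fixes-7 : Fixes 7
  fixes-7 g = fixes-by-avoidance 7 g (avoids-3*-halved 5 fixes-5 (λ ()) g) (avoids-9* 4 fixes-4 (λ ()) g)

  fixes-8 : Fixes 8
  fixes-8 g = fixes-by-avoidance 8 g (avoids-3*-halved 7 fixes-7 (λ ()) g) (avoids-9* 5 fixes-5 (λ ()) g)

  fixes-coprime : ∀ k → ¬ 3 ∣ k → Fixes k
  fixes-coprime = <-rec (λ k → ¬ 3 ∣ k → Fixes k) fixes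
    where
    fixes : ∀ k → (∀ {i} → i < k → ¬ 3 ∣ i → Fixes i) → ¬ 3 ∣ k → Fixes k
    fixes 0 _ 3∤0 = contradiction (3 ∣0) 3∤0
    fixes 1 _ _   = fixes-1
    fixes 2 _ _   = fixes-2
    fixes 3 _ 3∤3 = contradiction (divides 1 refl) 3∤3
    fixes 4 _ _   = fixes-4
    fixes 5 _ _   = fixes-5
    fixes 6 _ 3∤6 = contradiction (divides 2 refl) 3∤6
    fixes 7 _ _   = fixes-7
    fixes 8 _ _   = fixes-8
    fixes 9 _ 3∤9 = contradiction (divides 3 refl) 3∤9
    fixes k@(suc (suc (suc (suc (suc (suc (suc (suc (suc (suc m)))))))))) rec 3∤k g =
      fixes-by-avoidance k g
        (avoids-3* (1 ℕ.+ m) (rec (ℕ.m<n+m (1 ℕ.+ m) {9} (ℕ.s≤s ℕ.z≤n)) (3∤k ∘ ∣m∣n⇒∣m+n (divides 3 refl))) (λ ()) g)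
        (avoids-9* (7 ℕ.+ m) (rec (ℕ.m<n+m (7 ℕ.+ m) {3} (ℕ.s≤s ℕ.z≤n)) (3∤k ∘ ∣m∣n⇒∣m+n (divides 1 refl))) (λ ()) g)

lemma25 : (c : Coloring) → NoMonoSolution c →
    (x : ℚ) → x ≢ 0ℚ → c x ≡ c (ℕtoℚ 2 * x) →
    (n : ℕ) → .{{_ : NonZero n}} →
    (c (ℕtoℚ n * x) ≡ c x) ⇔ V3MultipleOf3 n
lemma25 c noMono x x≢0 c[x]≡c[2x] n with 3-adic-split n
... | e , j , n≡3^e*j , 3∤j = mk⇔
  (λ c[nx]≡c[x] → Equivalence.from (V3MultipleOf3⇔ {n} {e} v₃[n]≡e)
     (colour-3^-residue g (e % 3) (ℕ.m%n<n e 3) (trans (sym c[nx]≡c[3^[e%3]x]) c[nx]≡c[x])))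
  (λ 3∣v₃[n] → trans c[nx]≡c[3^[e%3]x]
     (subst (λ r → c (ℕtoℚ (3 ^ r) * x) ≡ c x) (sym (Equivalence.to (V3MultipleOf3⇔ {n} {e} v₃[n]≡e) 3∣v₃[n]))
            (colour-1* x)))
  where
  open Colouring c noMono
  open ≡-Reasoning
  g : Good x
  g = x≢0 , c[x]≡c[2x]
  v₃[n]≡e : V3 n e
  v₃[n]≡e = subst (λ m → V3 m e) (sym n≡3^e*j) (V3-3^e*j e 3∤j)
  c[nx]≡c[3^[e%3]x] : c (ℕtoℚ n * x) ≡ c (ℕtoℚ (3 ^ (e % 3)) * x)
  c[nx]≡c[3^[e%3]x] = begin
    c (ℕtoℚ n * x)                   ≡⟨ cong (λ m → c (ℕtoℚ m * x)) (trans n≡3^e*j (ℕ.*-comm (3 ^ e) j)) ⟩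
    c (ℕtoℚ (j ℕ.* 3 ^ e) * x)       ≡⟨ cong c (ℕtoℚ-*-assoc j (3 ^ e) x) ⟩
    c (ℕtoℚ j * (ℕtoℚ (3 ^ e) * x))  ≡⟨ fixes-coprime j 3∤j (good-3^ e g) ⟩
    c (ℕtoℚ (3 ^ e) * x)             ≡⟨ colour-3^ g e ⟩
    c (ℕtoℚ (3 ^ (e % 3)) * x)       ∎
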